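{- Let $T$ be an increasing balanced path diagram whose first rank is $r_1=0$. If Step 3 of Algorithm $\mathrm{HPath}^{\phi_k^{ -1}}$ is applied to $T$ (after Step 2 stops early), the resulting path diagram is again an increasing balanced path diagram with $r_1=0$. Moreover, a stable path diagram is an increasing balanced path diagram.
   Context: A path diagram $T(P,R)$, $P=(b_1,\dots,b_N)$, $R=(r_1,\dots,r_N)$, consists of arrows $A_i=(1,b_i)$ starting at $(i,r_i)$ with end rank $r_i+b_i$. Red arrow: $b_i>0$, segment in row $j$ (strip between heights $j,j+1$) iff $r_i\le j\le r_i+b_i-1$; blue: $b_i<0$, segment in row $j$ iff $r_i+b_i\le j\le r_i-1$. Row count $c(j)$ = #red minus #blue segments in row $j$; balanced: all $c(j)=0$; increasing: $r_1\le\dots\le r_N$. Fix $\phi=(\phi_1,\phi_2,\dots)$, $\phi_i\in\mathfrak S_i$. Algorithm $\mathrm{HPath}^{\phi_k^{ -1}}$ on an increasing balanced $T$: Step 1: current level $:=0$, $\mathfrak n:=0$, $k:=$ number of arrows of the current $T$ starting at level $0$. Step 2: for $i=1,\dots,N$: if the current level is $0$, set $\mathfrak n:=\mathfrak n+1$ and let $A_j$ be the $\phi_k^{ -1}(\mathfrak n)$-th arrow from the left among those starting at level $0$; otherwise let $A_j$ be the rightmost unlabelled arrow starting at the current level. If none exists, go to Step 3; else label $A_j$ by $i$, set $\pi(i)=j$, and current level $:=$ end rank of $A_j$. Step 3: shift all unlabelled arrows one level down, erase all labels, go to Step 1. Step 4: when all $N$ arrows are labelled in Step 2, output $(b_{\pi(1)},\dots,b_{\pi(N)})$.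 The diagram obtained from $T$ by the (possibly zero) Step 3 updates, at which Step 2 labels all $N$ arrows, is called stable. -}

module Defs where

open import Data.Nat as ℕ using (ℕ; zero; suc)
open import Data.Integer as ℤ using (ℤ; +_; _+_; _-_; 0ℤ; 1ℤ)
import Data.Integer.Properties as ℤP
open import Data.Fin as Fin using (Fin)
open import Data.Fin.Permutation using (Permutation′; _⟨$⟩ˡ_)
open import Data.List as List using (List; []; _∷_; _++_; [_]; length; filterᵇ; allFin; last)
open import Data.Bool.ListAction using (any)
open import Data.Maybe using (Maybe; just; nothing)
open import Data.Bool using (Bool; true; false; _∧_; not; if_then_else_)
open import Data.Product using (_×_)
open import Data.Unit using (⊤)
open import Relation.Nullary using (¬_)
open import Relation.Nullary.Decidable using (⌊_⌋)
open import Relation.Binary.PropositionalEquality using (_≡_)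

-- A path diagram T(P,R) with N arrows: P = (b_1..b_N), R = (r_1..r_N),
-- indexed by Fin N (index 0 is arrow A_1).
record PathDiagram (N : ℕ) : Set where
  constructor pd
  field
    b : Fin N → ℤ
    r : Fin N → ℤ
open PathDiagram public

_≤ᵇℤ_ : ℤ → ℤ → Bool
x ≤ᵇℤ y = ⌊ x ℤP.≤? y ⌋

_==ℤ_ : ℤ → ℤ → Bool
x ==ℤ y = ⌊ x ℤP.≟ y ⌋

_==F_ : ∀ {N} → Fin N → Fin N → Bool
i ==F j = ⌊ i Fin.≟ j ⌋

redIn : ∀ {N} → PathDiagram N → Fin N → ℤ → Bool
redIn T i j = (1ℤ ≤ᵇℤ b T i) ∧ (r T i ≤ᵇℤ j) ∧ (j ≤ᵇℤ (r T i + b T i - 1ℤ))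

blueIn : ∀ {N} → PathDiagram N → Fin N → ℤ → Bool
blueIn T i j = (b T i ≤ᵇℤ ℤ.-1ℤ) ∧ ((r T i + b T i) ≤ᵇℤ j) ∧ (j ≤ᵇℤ (r T i - 1ℤ))

rowCount : ∀ {N} → PathDiagram N → ℤ → ℤ
rowCount {N} T j =
  + length (filterᵇ (λ i → redIn T i j) (allFin N))
  - + length (filterᵇ (λ i → blueIn T i j) (allFin N))

Balanced : ∀ {N} → PathDiagram N → Set
Balanced T = ∀ (j : ℤ) → rowCount T j ≡ 0ℤ

Increasing : ∀ {N} → PathDiagram N → Set
Increasing {N} T = ∀ (i j : Fin N) → i Fin.≤ j → r T i ℤ.≤ r T j

FirstRankZero : ∀ {N} → PathDiagram N → Set
FirstRankZero {zero}  T = ⊤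
FirstRankZero {suc n} T = r T Fin.zero ≡ 0ℤ

NonzeroSteps : ∀ {N} → PathDiagram N → Set
NonzeroSteps {N} T = ∀ (i : Fin N) → ¬ (b T i ≡ 0ℤ)

NonnegRanks : ∀ {N} → PathDiagram N → Set
NonnegRanks {N} T = ∀ (i : Fin N) → 0ℤ ℤ.≤ r T i

-- φ = (φ_1, φ_2, ...), φ_k ∈ S_k (also φ_0 ∈ S_0, irrelevant)
PermSeq : Set
PermSeq = (k : ℕ) → Permutation′ k

module _ {N : ℕ} (φ : PermSeq) (T : PathDiagram N) where

  isLabelled : List (Fin N) → Fin N → Bool
  isLabelled labs j = any (j ==F_) labs

  level0 : List (Fin N)
  level0 = filterᵇ (λ j → r T j ==ℤ 0ℤ) (allFin N)

  chooseAt0 : ℕ → Maybe (Fin N)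
  chooseAt0 zero = nothing
  chooseAt0 (suc m) with m ℕ.<? length level0
  ... | Relation.Nullary.yes m<k =
          just (List.lookup level0 (φ (length level0) ⟨$⟩ˡ Fin.fromℕ< m<k))
  ... | Relation.Nullary.no _ = nothing

  chooseAt : ℤ → List (Fin N) → Maybe (Fin N)
  chooseAt ℓ labs =
    last (filterᵇ (λ j → (r T j ==ℤ ℓ) ∧ not (isLabelled labs j)) (allFin N))

  -- loop of Step 2: remaining iterations, current level, 𝔫, labelled arrows
  -- (the list lists π(1), π(2), ... in order)
  step2-go : ℕ → ℤ → ℕ → List (Fin N) → List (Fin N)
  step2-go zero ℓ 𝔫 labs = labs
  step2-go (suc f) ℓ 𝔫 labs with ℓ ==ℤ 0ℤ
  ... | true with chooseAt0 (suc 𝔫)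
  ...   | nothing = labs
  ...   | just j  = step2-go f (r T j + b T j) (suc 𝔫) (labs ++ [ j ])
  step2-go (suc f) ℓ 𝔫 labs | false with chooseAt ℓ labs
  ...   | nothing = labs
  ...   | just j  = step2-go f (r T j + b T j) 𝔫 (labs ++ [ j ])

  step2 : List (Fin N)
  step2 = step2-go N 0ℤ 0 []

  Step2Complete : Set
  Step2Complete = length step2 ≡ N

  step3 : PathDiagram N
  step3 = pd (b T) (λ j → if isLabelled step2 j then r T j else r T j - 1ℤ)

data Updates {N : ℕ} (φ : PermSeq) (T : PathDiagram N) : PathDiagram N → Set where
  done : Updates φ T T
  next : ∀ {T'} → Updates φ T T' → ¬ Step2Complete φ T' → Updates φ T (step3 φ T')

Stable : ∀ {N} → PermSeq → PathDiagram N → PathDiagram N → Set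
Stable φ T S = Updates φ T S × Step2Complete φ S

-- Arrow i contributes to row j the signed indicator of j ∈ [r_i, r_i + b_i), so the arrows
-- labelled by Step 2, which form a path from level 0 to the current level ℓ, contribute that of
-- [0, ℓ). Comparing the arrows starting and ending at a level ℓ ≠ 0 then yields, by balance, an
-- unlabelled arrow starting at ℓ; so Step 2 can only stop early back at level 0, once every
-- level-0 arrow is labelled. At that point the labelled arrows are balanced on their own, hence
-- so are the unlabelled ones after being lowered by one level; and since at each level the
-- labelled arrows are the rightmost ones, lowering the others keeps the ranks increasing.
-- Stable diagrams follow by induction along the Step 3 updates.

module Submission where

open import Defs
open import Data.Nat as ℕ using (ℕ)
open import Data.Product using (_×_; _,_; proj₁; proj₂; ∃-syntax; Σ-syntax)
open import Relation.Nullary using (¬_; Dec; yes; no; contradiction)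

open import Data.Bool using (Bool; true; false; not; _∧_; _∨_; if_then_else_)
open import Data.Bool.ListAction using (any)
open import Data.Bool.Properties using (T-≡; ∨-identityʳ; ∨-zeroʳ; ∨-assoc)
open import Data.Empty using (⊥-elim)
open import Data.Fin as Fin using (Fin; zero; suc)
import Data.Fin.Properties as FinP
open import Data.Fin.Permutation using (_⟨$⟩ʳ_; _⟨$⟩ˡ_; inverseˡ; inverseʳ)
open import Data.Integer as ℤ using (ℤ; +_; +[1+_]; -[1+_]; _+_; _-_; -_; 0ℤ; 1ℤ; -1ℤ)
import Data.Integer.Properties as ℤP
open import Algebra.Properties.AbelianGroup ℤP.+-0-abelianGroup using (inverseʳ-unique)
open import Algebra.Properties.Semiring.Sum ℤP.+-*-semiring
  using (sum; sum-cong-≗; sum-replicate-zero; ∑-distrib-+)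
open import Data.Integer.Tactic.RingSolver using (solve-∀)
open import Data.List using (List; []; _∷_; _++_; [_]; length; filterᵇ; allFin; tabulate; last; lookup)
import Data.List.Properties as ListP
open import Data.List.Membership.Propositional.Properties using (∈-filter⁺; ∈-filter⁻; ∈-lookup; ∈-allFin)
import Data.List.Relation.Unary.All as All
open import Data.List.Relation.Unary.AllPairs using (_∷_)
import Data.List.Relation.Unary.Any as Any
open import Data.List.Relation.Unary.Any.Properties using (lookup-index)
open import Data.List.Relation.Unary.Unique.Propositional using (Unique)
import Data.List.Relation.Unary.Unique.Propositional.Properties as UniqueP
open import Data.Maybe using (just; nothing)
import Data.Nat.Properties as ℕP
open import Data.Sum using (_⊎_; inj₁; inj₂)
open import Data.Unit using (tt)
open import Function using (_∘_; id; _⇔_; mk⇔)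
open import Function.Bundles using (module Equivalence)
open import Relation.Nullary.Decidable using (T?; ⌊_⌋; isYes≗does; does-⇔; dec-true; dec-false; ⌊⌋-map′)
open import Relation.Binary.PropositionalEquality
  using (_≡_; _≢_; refl; sym; trans; cong; cong₂; subst; subst₂; module ≡-Reasoning)

⌊⌋-⇔ : ∀ {A B : Set} → A ⇔ B → (a? : Dec A) (b? : Dec B) → ⌊ a? ⌋ ≡ ⌊ b? ⌋
⌊⌋-⇔ A⇔B a? b? = trans (isYes≗does a?) (trans (does-⇔ A⇔B a? b?) (sym (isYes≗does b?)))

⌊⌋-true : ∀ {A : Set} (a? : Dec A) → A → ⌊ a? ⌋ ≡ true
⌊⌋-true a? a = trans (isYes≗does a?) (dec-true a? a)

⌊⌋-false : ∀ {A : Set} (a? : Dec A) → ¬ A → ⌊ a? ⌋ ≡ false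
⌊⌋-false a? ¬a = trans (isYes≗does a?) (dec-false a? ¬a)

⌊⌋-sound : ∀ {A : Set} (a? : Dec A) → ⌊ a? ⌋ ≡ true → A
⌊⌋-sound (yes a) _ = a

⟦_⟧ : Bool → ℤ
⟦ true  ⟧ = 1ℤ
⟦ false ⟧ = 0ℤ

segment : ℤ → ℤ → ℤ → ℤ
segment a c j = ⟦ a ≤ᵇℤ j ⟧ - ⟦ c ≤ᵇℤ j ⟧

≤-1⇔< : ∀ {i j} → i ℤ.≤ j - 1ℤ ⇔ i ℤ.< j
≤-1⇔< {i} {j} = mk⇔ (ℤP.i≤pred[j]⇒i<j ∘ subst (i ℤ.≤_) (ℤP.+-comm j -1ℤ))
                    (subst (i ℤ.≤_) (ℤP.+-comm -1ℤ j) ∘ ℤP.i<j⇒i≤pred[j])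

≤ᵇℤ-pred : ∀ j c → (j ≤ᵇℤ (c - 1ℤ)) ≡ not (c ≤ᵇℤ j)
≤ᵇℤ-pred j c with j ℤP.≤? c - 1ℤ | c ℤP.≤? j
... | yes j≤c-1 | yes c≤j = ⊥-elim (ℤP.<-irrefl refl (ℤP.<-≤-trans (Equivalence.to ≤-1⇔< j≤c-1) c≤j))
... | yes _     | no _    = refl
... | no _      | yes _   = refl
... | no j≰c-1  | no c≰j  = ⊥-elim (j≰c-1 (Equivalence.from ≤-1⇔< (ℤP.≰⇒> c≰j)))

≤ᵇℤ-+-cancelʳ : ∀ x y k → ((x + k) ≤ᵇℤ (y + k)) ≡ (x ≤ᵇℤ y)
≤ᵇℤ-+-cancelʳ x y k = ⌊⌋-⇔ (mk⇔ cancel (ℤP.+-monoˡ-≤ k)) ((x + k) ℤP.≤? (y + k)) (x ℤP.≤? y)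
  where
  undo : ∀ z k → z + k - k ≡ z
  undo = solve-∀
  cancel : x + k ℤ.≤ y + k → x ℤ.≤ y
  cancel p = subst₂ ℤ._≤_ (undo x k) (undo y k) (ℤP.+-monoˡ-≤ (- k) p)

≤ᵇℤ-pred-+1 : ∀ a j → ((a - 1ℤ) ≤ᵇℤ j) ≡ (a ≤ᵇℤ (j + 1ℤ))
≤ᵇℤ-pred-+1 a j = trans (sym (≤ᵇℤ-+-cancelʳ (a - 1ℤ) j 1ℤ)) (cong (_≤ᵇℤ (j + 1ℤ)) (cancel a))
  where
  cancel : ∀ a → a - 1ℤ + 1ℤ ≡ a
  cancel = solve-∀

≤ᵇℤ-jump : ∀ a j → ⟦ a ≤ᵇℤ j ⟧ - ⟦ a ≤ᵇℤ (j - 1ℤ) ⟧ ≡ ⟦ a ==ℤ j ⟧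
≤ᵇℤ-jump a j rewrite ≤ᵇℤ-pred a j with a ℤP.≤? j | j ℤP.≤? a | a ℤP.≟ j
... | yes _   | yes _   | yes _   = refl
... | yes a≤j | yes j≤a | no a≢j  = ⊥-elim (a≢j (ℤP.≤-antisym a≤j j≤a))
... | yes _   | no j≰a  | yes a≡j = ⊥-elim (j≰a (ℤP.≤-reflexive (sym a≡j)))
... | yes _   | no _    | no _    = refl
... | no a≰j  | _       | yes a≡j = ⊥-elim (a≰j (ℤP.≤-reflexive a≡j))
... | no _    | yes _   | no _    = refl
... | no a≰j  | no j≰a  | no _    = ⊥-elim (a≰j (ℤP.<⇒≤ (ℤP.≰⇒> j≰a)))

interval≡segment : ∀ {a c} j → a ℤ.≤ c → ⟦ (a ≤ᵇℤ j) ∧ (j ≤ᵇℤ (c - 1ℤ)) ⟧ ≡ segment a c j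
interval≡segment {a} {c} j a≤c rewrite ≤ᵇℤ-pred j c with a ℤP.≤? j | c ℤP.≤? j
... | yes _   | yes _   = refl
... | yes _   | no _    = refl
... | no a≰j  | yes c≤j = ⊥-elim (a≰j (ℤP.≤-trans a≤c c≤j))
... | no _    | no _    = refl

segment-jump : ∀ a c j → segment a c j - segment a c (j - 1ℤ) ≡ ⟦ a ==ℤ j ⟧ - ⟦ c ==ℤ j ⟧
segment-jump a c j = trans (regroup ⟦ a ≤ᵇℤ j ⟧ ⟦ c ≤ᵇℤ j ⟧ ⟦ a ≤ᵇℤ (j - 1ℤ) ⟧ ⟦ c ≤ᵇℤ (j - 1ℤ) ⟧)
                           (cong₂ _-_ (≤ᵇℤ-jump a j) (≤ᵇℤ-jump c j))
  where
  regroup : ∀ x y u v → (x - y) - (u - v) ≡ (x - u) - (y - v)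
  regroup = solve-∀

segment-lower : ∀ a c j → segment (a - 1ℤ) (c - 1ℤ) j ≡ segment a c (j + 1ℤ)
segment-lower a c j = cong₂ (λ x y → ⟦ x ⟧ - ⟦ y ⟧) (≤ᵇℤ-pred-+1 a j) (≤ᵇℤ-pred-+1 c j)

segment-trans : ∀ a b c j → segment a b j + segment b c j ≡ segment a c j
segment-trans a b c j = telescope ⟦ a ≤ᵇℤ j ⟧ ⟦ b ≤ᵇℤ j ⟧ ⟦ c ≤ᵇℤ j ⟧
  where
  telescope : ∀ x y z → (x - y) + (y - z) ≡ x - z
  telescope = solve-∀

segment-flip : ∀ a c j → - segment a c j ≡ segment c a j
segment-flip a c j = flip ⟦ a ≤ᵇℤ j ⟧ ⟦ c ≤ᵇℤ j ⟧
  where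
  flip : ∀ x y → - (x - y) ≡ y - x
  flip = solve-∀

segment-self : ∀ a j → segment a a j ≡ 0ℤ
segment-self a j = ℤP.+-inverseʳ ⟦ a ≤ᵇℤ j ⟧

red-blue≡segment : ∀ r b j →
  ⟦ (1ℤ ≤ᵇℤ b) ∧ (r ≤ᵇℤ j) ∧ (j ≤ᵇℤ (r + b - 1ℤ)) ⟧
    - ⟦ (b ≤ᵇℤ -1ℤ) ∧ ((r + b) ≤ᵇℤ j) ∧ (j ≤ᵇℤ (r - 1ℤ)) ⟧
  ≡ segment r (r + b) j
red-blue≡segment r (+ 0) j =
  sym (trans (cong (λ c → segment r c j) (ℤP.+-identityʳ r)) (segment-self r j))
red-blue≡segment r +[1+ n ] j = trans (ℤP.+-identityʳ _) (interval≡segment j (ℤP.i≤i+j r +[1+ n ]))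
red-blue≡segment r -[1+ n ] j =
  trans (ℤP.+-identityˡ _)
        (trans (cong -_ (interval≡segment j (ℤP.i-j≤i r +[1+ n ]))) (segment-flip (r + -[1+ n ]) r j))

∧-not≡true : ∀ {a c} → a ∧ not c ≡ true → a ≡ true × c ≡ false
∧-not≡true {true} {false} _ = refl , refl

∧-not≡false : ∀ {a c} → a ∧ not c ≡ false → a ≡ true → c ≡ true
∧-not≡false {true} {true} _ _ = refl

any-snoc : ∀ {A : Set} (p : A → Bool) xs z → any p (xs ++ [ z ]) ≡ any p xs ∨ p z
any-snoc p []       z = ∨-identityʳ (p z)
any-snoc p (x ∷ xs) z = trans (cong (_∨_ (p x)) (any-snoc p xs z)) (sym (∨-assoc (p x) (any p xs) (p z)))

lookup-filterᵇ : ∀ {A : Set} (p : A → Bool) xs q → p (lookup (filterᵇ p xs) q) ≡ true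
lookup-filterᵇ p xs q = Equivalence.to T-≡ (proj₂ (∈-filter⁻ (T? ∘ p) {xs = xs} (∈-lookup q)))

filterᵇ-allFin-index : ∀ {n} (p : Fin n → Bool) x → p x ≡ true →
                       ∃[ q ] lookup (filterᵇ p (allFin n)) q ≡ x
filterᵇ-allFin-index p x px = Any.index x∈ , sym (lookup-index x∈)
  where x∈ = ∈-filter⁺ (T? ∘ p) (∈-allFin x) (Equivalence.from T-≡ px)

lookup-injective : ∀ {A : Set} {xs : List A} → Unique xs → ∀ a b → lookup xs a ≡ lookup xs b → a ≡ b
lookup-injective (_   ∷ _) zero    zero    _ = refl
lookup-injective (x∉ ∷ _) zero    (suc b) e = contradiction e (All.lookup x∉ (∈-lookup b))
lookup-injective (x∉ ∷ _) (suc a) zero    e = contradiction (sym e) (All.lookup x∉ (∈-lookup a))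
lookup-injective (_   ∷ u) (suc a) (suc b) e = cong suc (lookup-injective u a b e)

filterᵇ-tabulate-≡[] : ∀ {A : Set} {n} (p : A → Bool) (f : Fin n → A) →
                       filterᵇ p (tabulate f) ≡ [] → ∀ i → p (f i) ≡ false
filterᵇ-tabulate-≡[] {n = ℕ.suc n} p f e i with p (f zero) in p₀
filterᵇ-tabulate-≡[] {n = ℕ.suc n} p f () i       | true
filterᵇ-tabulate-≡[] {n = ℕ.suc n} p f e zero    | false = p₀
filterᵇ-tabulate-≡[] {n = ℕ.suc n} p f e (suc i) | false = filterᵇ-tabulate-≡[] p (f ∘ suc) e i

last≡nothing⇒≡[] : ∀ {A : Set} (xs : List A) → last xs ≡ nothing → xs ≡ []
last≡nothing⇒≡[] []           _ = refl
last≡nothing⇒≡[] (x ∷ y ∷ ys) e with () ← last≡nothing⇒≡[] (y ∷ ys) e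

RightmostIn : ∀ {A : Set} {n} → (A → Bool) → (Fin n → A) → A → Set
RightmostIn {n = n} p f z = ∃[ k ] f k ≡ z × p (f k) ≡ true × (∀ (i : Fin n) → k Fin.< i → p (f i) ≡ false)

rightmostIn-suc : ∀ {A : Set} {n} {p : A → Bool} {f : Fin (ℕ.suc n) → A} {z} →
                  RightmostIn p (f ∘ suc) z → RightmostIn p f z
rightmostIn-suc (k , fk≡z , pk , after) = suc k , fk≡z , pk , λ { (suc i) (ℕ.s≤s k<i) → after i k<i }

last-filterᵇ-tabulate : ∀ {A : Set} {n} (p : A → Bool) (f : Fin n → A) {z} →
                        last (filterᵇ p (tabulate f)) ≡ just z → RightmostIn p f z
last-filterᵇ-tabulate {n = ℕ.suc n} p f e with p (f zero) in p₀
... | false = rightmostIn-suc {p = p} (last-filterᵇ-tabulate p (f ∘ suc) e)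
... | true with filterᵇ p (tabulate (f ∘ suc)) in rest
...   | [] with refl ← e =
          zero , refl , p₀ , λ { (suc i) _ → filterᵇ-tabulate-≡[] p (f ∘ suc) rest i }
...   | _ ∷ _ = rightmostIn-suc {p = p} (last-filterᵇ-tabulate p (f ∘ suc) (trans (cong last rest) e))

keep : Bool → ℤ → ℤ
keep c x = if c then x else 0ℤ

keep-split : ∀ c x → keep c x + keep (not c) x ≡ x
keep-split true  x = ℤP.+-identityʳ x
keep-split false x = ℤP.+-identityˡ x

keep-distrib-- : ∀ c x y → keep c (x - y) ≡ keep c x - keep c y
keep-distrib-- true  x y = refl
keep-distrib-- false x y = refl

∑-neg : ∀ {n} (f : Fin n → ℤ) → sum (λ i → - f i) ≡ - sum f
∑-neg {ℕ.zero}  f = refl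
∑-neg {ℕ.suc n} f = trans (cong (_+_ (- f zero)) (∑-neg (f ∘ suc)))
                          (sym (ℤP.neg-distrib-+ (f zero) (sum (f ∘ suc))))

∑-distrib-- : ∀ {n} (f g : Fin n → ℤ) → sum (λ i → f i - g i) ≡ sum f - sum g
∑-distrib-- f g = trans (∑-distrib-+ f (λ i → - g i)) (cong (_+_ (sum f)) (∑-neg g))

∑-mono-≤ : ∀ {n} {f g : Fin n → ℤ} → (∀ i → f i ℤ.≤ g i) → sum f ℤ.≤ sum g
∑-mono-≤ {ℕ.zero}  f≤g = ℤP.≤-refl
∑-mono-≤ {ℕ.suc n} f≤g = ℤP.+-mono-≤ (f≤g zero) (∑-mono-≤ (f≤g ∘ suc))

∑-split : ∀ {n} (L : Fin n → Bool) (f : Fin n → ℤ) →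
          sum (λ i → keep (L i) (f i)) + sum (λ i → keep (not (L i)) (f i)) ≡ sum f
∑-split L f = trans (sym (∑-distrib-+ (λ i → keep (L i) (f i)) (λ i → keep (not (L i)) (f i))))
                    (sum-cong-≗ (λ i → keep-split (L i) (f i)))

∑-single : ∀ {n} (z : Fin n) (f : Fin n → ℤ) → sum (λ i → keep (i ==F z) (f i)) ≡ f z
∑-single {ℕ.suc n} zero    f = trans (cong (_+_ (f zero)) (sum-replicate-zero n)) (ℤP.+-identityʳ (f zero))
∑-single {ℕ.suc n} (suc z) f =
  trans (ℤP.+-identityˡ _) (trans (sum-cong-≗ suc-==F) (∑-single z (f ∘ suc)))
  where
  suc-==F : ∀ i → keep (suc i ==F suc z) (f (suc i)) ≡ keep (i ==F z) (f (suc i))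
  suc-==F i = cong (λ c → keep c (f (suc i))) (⌊⌋-map′ (cong suc) FinP.suc-injective (i Fin.≟ z))

+length-filterᵇ : ∀ {A : Set} {n} (p : A → Bool) (f : Fin n → A) →
                  + length (filterᵇ p (tabulate f)) ≡ sum (λ i → ⟦ p (f i) ⟧)
+length-filterᵇ {n = ℕ.zero}  p f = refl
+length-filterᵇ {n = ℕ.suc n} p f with p (f zero)
... | true  = cong (_+_ 1ℤ) (+length-filterᵇ p (f ∘ suc))
... | false = trans (+length-filterᵇ p (f ∘ suc)) (sym (ℤP.+-identityˡ _))

height : ∀ {N} → PathDiagram N → Fin N → ℤ → ℤ
height T i = segment (r T i) (r T i + b T i)

rowCount≡∑height : ∀ {N} (T : PathDiagram N) j → rowCount T j ≡ sum (λ i → height T i j)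
rowCount≡∑height {N} T j = begin
  rowCount T j
    ≡⟨ cong₂ _-_ (+length-filterᵇ (λ i → redIn T i j) id) (+length-filterᵇ (λ i → blueIn T i j) id) ⟩
  sum (λ i → ⟦ redIn T i j ⟧) - sum (λ i → ⟦ blueIn T i j ⟧)
    ≡⟨ sym (∑-distrib-- (λ i → ⟦ redIn T i j ⟧) (λ i → ⟦ blueIn T i j ⟧)) ⟩
  sum (λ i → ⟦ redIn T i j ⟧ - ⟦ blueIn T i j ⟧)
    ≡⟨ sum-cong-≗ (λ i → red-blue≡segment (r T i) (b T i) j) ⟩
  sum (λ i → height T i j) ∎
  where open ≡-Reasoning

flow : ∀ {N} → PathDiagram N → (Fin N → Bool) → ℤ → ℤ
flow T L j = sum (λ i → keep (L i) (height T i j))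

flow-complement : ∀ {N} (T : PathDiagram N) → Balanced T → ∀ L j →
                  flow T L j + flow T (not ∘ L) j ≡ 0ℤ
flow-complement T bal L j =
  trans (∑-split L (λ i → height T i j)) (trans (sym (rowCount≡∑height T j)) (bal j))

flow-jump : ∀ {N} (T : PathDiagram N) L j →
            flow T L j - flow T L (j - 1ℤ)
            ≡ sum (λ i → keep (L i) (⟦ r T i ==ℤ j ⟧ - ⟦ (r T i + b T i) ==ℤ j ⟧))
flow-jump T L j =
  trans (sym (∑-distrib-- (λ i → keep (L i) (height T i j)) (λ i → keep (L i) (height T i (j - 1ℤ)))))
        (sum-cong-≗ jump)
  where
  jump : ∀ i → keep (L i) (height T i j) - keep (L i) (height T i (j - 1ℤ))
             ≡ keep (L i) (⟦ r T i ==ℤ j ⟧ - ⟦ (r T i + b T i) ==ℤ j ⟧)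
  jump i = trans (sym (keep-distrib-- (L i) _ _)) (cong (keep (L i)) (segment-jump (r T i) (r T i + b T i) j))

flow-unlabelled : ∀ {N} (T : PathDiagram N) → Balanced T → ∀ L j → flow T (not ∘ L) j ≡ - flow T L j
flow-unlabelled T bal L j =
  inverseʳ-unique (flow T L j) (flow T (not ∘ L) j) (flow-complement T bal L j)

flow-snoc : ∀ {N} (T : PathDiagram N) {L z} → L z ≡ false → ∀ j →
            flow T (λ i → L i ∨ (i ==F z)) j ≡ flow T L j + height T z j
flow-snoc {N} T {L} {z} fresh j =
  trans (sum-cong-≗ split)
        (trans (∑-distrib-+ (λ i → keep (L i) (height T i j)) (λ i → keep (i ==F z) (height T i j)))
               (cong (_+_ (flow T L j)) (∑-single z (λ i → height T i j))))
  where
  split : ∀ i → keep (L i ∨ (i ==F z)) (height T i j)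
                ≡ keep (L i) (height T i j) + keep (i ==F z) (height T i j)
  split i with L i in Lᵢ | i Fin.≟ z
  ... | true  | yes refl = contradiction (trans (sym Lᵢ) fresh) λ ()
  ... | true  | no _     = sym (ℤP.+-identityʳ _)
  ... | false | yes refl = sym (ℤP.+-identityˡ _)
  ... | false | no _     = refl

-- Starts minus ends of arrows at level ℓ: over all arrows this is 0 by balance, over the labelled
-- ones it is -1, so the unlabelled ones contribute 1 and one of them must start at ℓ.
path-continues : ∀ {N} {T : PathDiagram N} {L : Fin N → Bool} {ℓ} → Balanced T → ℓ ≢ 0ℤ →
                 (∀ j → flow T L j ≡ segment 0ℤ ℓ j) → ¬ (∀ i → r T i ≡ ℓ → L i ≡ true)
path-continues {N} {T} {L} {ℓ} bal ℓ≢0 path ℓ-labelled =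
  contradiction (subst (ℤ._≤ 0ℤ) unlabelled≡1 unlabelled≤0) λ { (ℤ.+≤+ ()) }
  where
  startsMinusEnds : Fin N → ℤ
  startsMinusEnds i = ⟦ r T i ==ℤ ℓ ⟧ - ⟦ (r T i + b T i) ==ℤ ℓ ⟧
  unlabelled≡1 : sum (λ i → keep (not (L i)) (startsMinusEnds i)) ≡ 1ℤ
  unlabelled≡1 = begin
    sum (λ i → keep (not (L i)) (startsMinusEnds i))
      ≡⟨ sym (flow-jump T (not ∘ L) ℓ) ⟩
    flow T (not ∘ L) ℓ - flow T (not ∘ L) (ℓ - 1ℤ)
      ≡⟨ cong₂ _-_ (flow-unlabelled T bal L ℓ) (flow-unlabelled T bal L (ℓ - 1ℤ)) ⟩
    - flow T L ℓ - - flow T L (ℓ - 1ℤ)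
      ≡⟨ neg-sub (flow T L ℓ) (flow T L (ℓ - 1ℤ)) ⟩
    - (flow T L ℓ - flow T L (ℓ - 1ℤ))
      ≡⟨ cong₂ (λ x y → - (x - y)) (path ℓ) (path (ℓ - 1ℤ)) ⟩
    - (segment 0ℤ ℓ ℓ - segment 0ℤ ℓ (ℓ - 1ℤ))
      ≡⟨ cong -_ (segment-jump 0ℤ ℓ ℓ) ⟩
    - (⟦ 0ℤ ==ℤ ℓ ⟧ - ⟦ ℓ ==ℤ ℓ ⟧)
      ≡⟨ cong₂ (λ x y → - (⟦ x ⟧ - ⟦ y ⟧)) (⌊⌋-false (0ℤ ℤP.≟ ℓ) (ℓ≢0 ∘ sym)) (⌊⌋-true (ℓ ℤP.≟ ℓ) refl) ⟩
    1ℤ ∎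
    where
    open ≡-Reasoning
    neg-sub : ∀ x y → - x - - y ≡ - (x - y)
    neg-sub = solve-∀
  unlabelled≤0 : sum (λ i → keep (not (L i)) (startsMinusEnds i)) ℤ.≤ 0ℤ
  unlabelled≤0 = subst (sum (λ i → keep (not (L i)) (startsMinusEnds i)) ℤ.≤_)
                       (sum-replicate-zero N) (∑-mono-≤ nonpositive)
    where
    nonpositive : ∀ i → keep (not (L i)) (startsMinusEnds i) ℤ.≤ 0ℤ
    nonpositive i with r T i ℤP.≟ ℓ
    ... | yes rᵢ≡ℓ rewrite ℓ-labelled i rᵢ≡ℓ = ℤP.≤-refl
    ... | no _ with L i | (r T i + b T i) ==ℤ ℓ
    ...   | true  | _     = ℤP.≤-refl
    ...   | false | true  = ℤ.-≤+
    ...   | false | false = ℤP.≤-refl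

-- Step 3 for a labelling L: step3 φ T is lowerUnlabelled T (isLabelled φ T (step2 φ T)) by definition.
lowerUnlabelled : ∀ {N} → PathDiagram N → (Fin N → Bool) → PathDiagram N
lowerUnlabelled T L = pd (b T) (λ i → if L i then r T i else r T i - 1ℤ)

lowerUnlabelled-labelled : ∀ {N} (T : PathDiagram N) {L} x → L x ≡ true → r (lowerUnlabelled T L) x ≡ r T x
lowerUnlabelled-labelled T {L} x Lx = cong (λ c → if c then r T x else r T x - 1ℤ) Lx

RightClosed : ∀ {N} → PathDiagram N → (Fin N → Bool) → Set
RightClosed {N} T L = ∀ (x y : Fin N) → x Fin.≤ y → r T x ≡ r T y → L x ≡ true → L y ≡ true

height-lowerUnlabelled : ∀ {N} (T : PathDiagram N) L i j →
  height (lowerUnlabelled T L) i j ≡ keep (L i) (height T i j) + keep (not (L i)) (height T i (j + 1ℤ))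
height-lowerUnlabelled T L i j with L i
... | true  = sym (ℤP.+-identityʳ _)
... | false = trans (cong (λ c → segment (r T i - 1ℤ) c j) (swap (r T i) (b T i)))
                    (trans (segment-lower (r T i) (r T i + b T i) j) (sym (ℤP.+-identityˡ _)))
  where
  swap : ∀ x y → x - 1ℤ + y ≡ x + y - 1ℤ
  swap = solve-∀

lowerUnlabelled-balanced : ∀ {N} (T : PathDiagram N) L → Balanced T → (∀ j → flow T L j ≡ 0ℤ) →
                           Balanced (lowerUnlabelled T L)
lowerUnlabelled-balanced {N} T L bal closed j = begin
  rowCount (lowerUnlabelled T L) j
    ≡⟨ rowCount≡∑height (lowerUnlabelled T L) j ⟩
  sum (λ i → height (lowerUnlabelled T L) i j)
    ≡⟨ sum-cong-≗ (λ i → height-lowerUnlabelled T L i j) ⟩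
  sum (λ i → keep (L i) (height T i j) + keep (not (L i)) (height T i (j + 1ℤ)))
    ≡⟨ ∑-distrib-+ (λ i → keep (L i) (height T i j)) (λ i → keep (not (L i)) (height T i (j + 1ℤ))) ⟩
  flow T L j + flow T (not ∘ L) (j + 1ℤ)
    ≡⟨ cong₂ _+_ (closed j) (trans (flow-unlabelled T bal L (j + 1ℤ)) (cong -_ (closed (j + 1ℤ)))) ⟩
  0ℤ ∎
  where open ≡-Reasoning

lowerUnlabelled-increasing : ∀ {N} (T : PathDiagram N) L → Increasing T → RightClosed T L →
                             Increasing (lowerUnlabelled T L)
lowerUnlabelled-increasing T L inc closed x y x≤y with L x in Lx | L y in Ly
... | true  | true  = inc x y x≤y
... | false | false = ℤP.+-monoˡ-≤ -1ℤ (inc x y x≤y)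
... | false | true  = ℤP.≤-trans (ℤP.i-j≤i (r T x) 1ℤ) (inc x y x≤y)
... | true  | false with r T x ℤP.≟ r T y
...   | yes same = contradiction (trans (sym (closed x y x≤y same Lx)) Ly) λ ()
...   | no differ = Equivalence.from ≤-1⇔< (ℤP.≤∧≢⇒< (inc x y x≤y) differ)

-- The labelling left by Step 2 when it stops early.
record ClosedLabelling {N} (T : PathDiagram N) (L : Fin N → Bool) : Set where
  field
    flow-zero       : ∀ j → flow T L j ≡ 0ℤ
    level0-labelled : ∀ x → r T x ≡ 0ℤ → L x ≡ true
    right-closed    : RightClosed T L

module Step2 (φ : PermSeq) {N : ℕ} (T : PathDiagram N) where

  labelled : List (Fin N) → Fin N → Bool
  labelled = isLabelled φ T

  end : Fin N → ℤ
  end z = r T z + b T z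

  k : ℕ
  k = length (level0 φ T)

  -- pick m is the level-0 arrow taken by Step 2 when 𝔫 = m + 1.
  pick : (m : ℕ) → m ℕ.< k → Fin N
  pick m m<k = lookup (level0 φ T) (φ k ⟨$⟩ˡ Fin.fromℕ< m<k)

  pick-rank : ∀ m m<k → r T (pick m m<k) ≡ 0ℤ
  pick-rank m m<k = ⌊⌋-sound (r T (pick m m<k) ℤP.≟ 0ℤ) (lookup-filterᵇ (λ j → r T j ==ℤ 0ℤ) (allFin N) _)

  pick-injective : ∀ {m m′} m<k m′<k → pick m m<k ≡ pick m′ m′<k → m ≡ m′
  pick-injective {m} {m′} m<k m′<k same = FinP.fromℕ<-injective m m′ m<k m′<k (begin
    Fin.fromℕ< m<k                          ≡⟨ sym (inverseʳ (φ k)) ⟩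
    φ k ⟨$⟩ʳ (φ k ⟨$⟩ˡ Fin.fromℕ< m<k)     ≡⟨ cong (φ k ⟨$⟩ʳ_) (lookup-injective level0-unique _ _ same) ⟩
    φ k ⟨$⟩ʳ (φ k ⟨$⟩ˡ Fin.fromℕ< m′<k)    ≡⟨ inverseʳ (φ k) ⟩
    Fin.fromℕ< m′<k                         ∎)
    where
    open ≡-Reasoning
    level0-unique : Unique (level0 φ T)
    level0-unique = UniqueP.filter⁺ (T? ∘ λ j → r T j ==ℤ 0ℤ) (UniqueP.allFin⁺ N)

  pick-surjective : ∀ x → r T x ≡ 0ℤ → ∃[ m ] Σ[ m<k ∈ m ℕ.< k ] pick m m<k ≡ x
  pick-surjective x rx≡0 with filterᵇ-allFin-index (λ j → r T j ==ℤ 0ℤ) x (⌊⌋-true (r T x ℤP.≟ 0ℤ) rx≡0)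
  ... | q , q↦x = Fin.toℕ (φ k ⟨$⟩ʳ q) , FinP.toℕ<n (φ k ⟨$⟩ʳ q) , (begin
    lookup (level0 φ T) (φ k ⟨$⟩ˡ Fin.fromℕ< (FinP.toℕ<n (φ k ⟨$⟩ʳ q)))
      ≡⟨ cong (λ i → lookup (level0 φ T) (φ k ⟨$⟩ˡ i))
              (FinP.fromℕ<-toℕ (φ k ⟨$⟩ʳ q) (FinP.toℕ<n (φ k ⟨$⟩ʳ q))) ⟩
    lookup (level0 φ T) (φ k ⟨$⟩ˡ (φ k ⟨$⟩ʳ q))
      ≡⟨ cong (lookup (level0 φ T)) (inverseˡ (φ k)) ⟩
    lookup (level0 φ T) q
      ≡⟨ q↦x ⟩
    x ∎)
    where open ≡-Reasoning

  Picked : ℕ → Fin N → Set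
  Picked n x = ∃[ m ] Σ[ m<k ∈ m ℕ.< k ] m ℕ.< n × pick m m<k ≡ x

  labelled-snoc : ∀ labs z i → labelled (labs ++ [ z ]) i ≡ labelled labs i ∨ (i ==F z)
  labelled-snoc labs z i = any-snoc (i ==F_) labs z

  labelled-snoc⁺ : ∀ labs z i → labelled labs i ≡ true → labelled (labs ++ [ z ]) i ≡ true
  labelled-snoc⁺ labs z i old = trans (labelled-snoc labs z i) (cong (_∨ (i ==F z)) old)

  labelled-snoc-new : ∀ labs z → labelled (labs ++ [ z ]) z ≡ true
  labelled-snoc-new labs z =
    trans (labelled-snoc labs z z)
          (trans (cong (_∨_ (labelled labs z)) (⌊⌋-true (z Fin.≟ z) refl)) (∨-zeroʳ _))

  labelled-snoc⁻ : ∀ labs z i → labelled (labs ++ [ z ]) i ≡ true → labelled labs i ≡ true ⊎ i ≡ z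
  labelled-snoc⁻ labs z i new rewrite labelled-snoc labs z i with labelled labs i | i Fin.≟ z
  ... | true  | _       = inj₁ refl
  ... | false | yes i≡z = inj₂ i≡z

  fuel-snoc : ∀ labs (z : Fin N) {f} → length labs ℕ.+ ℕ.suc f ≡ N → length (labs ++ [ z ]) ℕ.+ f ≡ N
  fuel-snoc labs z {f} e =
    trans (cong (ℕ._+ f) (ListP.length-++ labs)) (trans (ℕP.+-assoc (length labs) 1 f) e)

  trail-snoc : ∀ labs z {ℓ} → labelled labs z ≡ false → r T z ≡ ℓ →
               (∀ j → flow T (labelled labs) j ≡ segment 0ℤ ℓ j) →
               ∀ j → flow T (labelled (labs ++ [ z ])) j ≡ segment 0ℤ (end z) j
  trail-snoc labs z {ℓ} fresh rz≡ℓ trail j = begin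
    flow T (labelled (labs ++ [ z ])) j
      ≡⟨ sum-cong-≗ (λ i → cong (λ c → keep c (height T i j)) (labelled-snoc labs z i)) ⟩
    flow T (λ i → labelled labs i ∨ (i ==F z)) j
      ≡⟨ flow-snoc T fresh j ⟩
    flow T (labelled labs) j + segment (r T z) (end z) j
      ≡⟨ cong₂ _+_ (trail j) (cong (λ a → segment a (end z) j) rz≡ℓ) ⟩
    segment 0ℤ ℓ j + segment ℓ (end z) j
      ≡⟨ segment-trans 0ℤ ℓ (end z) j ⟩
    segment 0ℤ (end z) j ∎
    where open ≡-Reasoning

  record Invariant (fuel : ℕ) (ℓ : ℤ) (n : ℕ) (labs : List (Fin N)) : Set where
    field
      fuel-sum        : length labs ℕ.+ fuel ≡ N
      trail           : ∀ j → flow T (labelled labs) j ≡ segment 0ℤ ℓ j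
      level0-picked   : ∀ x → labelled labs x ≡ true → r T x ≡ 0ℤ → Picked n x
      picked-labelled : ∀ x → Picked n x → labelled labs x ≡ true
      right-closed    : ∀ x y → x Fin.≤ y → r T x ≡ r T y → r T x ≢ 0ℤ →
                        labelled labs x ≡ true → labelled labs y ≡ true
  open Invariant

  invariant-start : Invariant N 0ℤ 0 []
  invariant-start = record
    { fuel-sum        = refl
    ; trail           = λ j → trans (sum-replicate-zero N) (sym (segment-self 0ℤ j))
    ; level0-picked   = λ _ ()
    ; picked-labelled = λ { _ (_ , _ , () , _) }
    ; right-closed    = λ _ _ _ _ _ ()
    }

  invariant-at0 : ∀ {f ℓ n labs} → Invariant (ℕ.suc f) ℓ n labs → ℓ ≡ 0ℤ → (n<k : n ℕ.< k) →
                  Invariant f (end (pick n n<k)) (ℕ.suc n) (labs ++ [ pick n n<k ])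
  invariant-at0 {f} {ℓ} {n} {labs} inv ℓ≡0 n<k = record
    { fuel-sum        = fuel-snoc labs z (fuel-sum inv)
    ; trail           = trail-snoc labs z fresh (trans (pick-rank n n<k) (sym ℓ≡0)) (trail inv)
    ; level0-picked   = picked-or-new
    ; picked-labelled = labelled-picked
    ; right-closed    = closed
    }
    where
    z = pick n n<k
    fresh : labelled labs z ≡ false
    fresh with labelled labs z in old
    ... | false = refl
    ... | true with level0-picked inv z old (pick-rank n n<k)
    ...   | m , m<k , m<n , m↦z = contradiction (pick-injective m<k n<k m↦z) (ℕP.<⇒≢ m<n)
    picked-or-new : ∀ x → labelled (labs ++ [ z ]) x ≡ true → r T x ≡ 0ℤ → Picked (ℕ.suc n) x
    picked-or-new x lab rx≡0 with labelled-snoc⁻ labs z x lab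
    ... | inj₂ refl = n , n<k , ℕP.n<1+n n , refl
    ... | inj₁ old with level0-picked inv x old rx≡0
    ...   | m , m<k , m<n , m↦x = m , m<k , ℕP.m<n⇒m<1+n m<n , m↦x
    labelled-picked : ∀ x → Picked (ℕ.suc n) x → labelled (labs ++ [ z ]) x ≡ true
    labelled-picked x (m , m<k , m<1+n , m↦x) with ℕP.m<1+n⇒m<n∨m≡n m<1+n
    ... | inj₁ m<n  = labelled-snoc⁺ labs z x (picked-labelled inv x (m , m<k , m<n , m↦x))
    ... | inj₂ refl rewrite sym m↦x | ℕP.<-irrelevant m<k n<k = labelled-snoc-new labs z
    closed : ∀ x y → x Fin.≤ y → r T x ≡ r T y → r T x ≢ 0ℤ →
             labelled (labs ++ [ z ]) x ≡ true → labelled (labs ++ [ z ]) y ≡ true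
    closed x y x≤y same rx≢0 lab with labelled-snoc⁻ labs z x lab
    ... | inj₁ old  = labelled-snoc⁺ labs z y (right-closed inv x y x≤y same rx≢0 old)
    ... | inj₂ refl = contradiction (pick-rank n n<k) rx≢0

  RightmostUnlabelled : ℤ → List (Fin N) → Fin N → Set
  RightmostUnlabelled ℓ labs z =
    r T z ≡ ℓ × labelled labs z ≡ false × (∀ y → z Fin.< y → r T y ≡ ℓ → labelled labs y ≡ true)

  invariant-away : ∀ {f ℓ n labs z} → Invariant (ℕ.suc f) ℓ n labs → ℓ ≢ 0ℤ →
                   RightmostUnlabelled ℓ labs z → Invariant f (end z) n (labs ++ [ z ])
  invariant-away {f} {ℓ} {n} {labs} {z} inv ℓ≢0 (rz≡ℓ , fresh , rightmost) = record
    { fuel-sum        = fuel-snoc labs z (fuel-sum inv)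
    ; trail           = trail-snoc labs z fresh rz≡ℓ (trail inv)
    ; level0-picked   = picked
    ; picked-labelled = λ x p → labelled-snoc⁺ labs z x (picked-labelled inv x p)
    ; right-closed    = closed
    }
    where
    picked : ∀ x → labelled (labs ++ [ z ]) x ≡ true → r T x ≡ 0ℤ → Picked n x
    picked x lab rx≡0 with labelled-snoc⁻ labs z x lab
    ... | inj₁ old  = level0-picked inv x old rx≡0
    ... | inj₂ refl = contradiction (trans (sym rz≡ℓ) rx≡0) ℓ≢0
    closed : ∀ x y → x Fin.≤ y → r T x ≡ r T y → r T x ≢ 0ℤ →
             labelled (labs ++ [ z ]) x ≡ true → labelled (labs ++ [ z ]) y ≡ true
    closed x y x≤y same rx≢0 lab with labelled-snoc⁻ labs z x lab
    ... | inj₁ old  = labelled-snoc⁺ labs z y (right-closed inv x y x≤y same rx≢0 old)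
    ... | inj₂ refl with x Fin.≟ y
    ...   | yes refl = labelled-snoc-new labs z
    ...   | no x≢y   = labelled-snoc⁺ labs z y (rightmost y (FinP.≤∧≢⇒< x≤y x≢y) (trans (sym same) rz≡ℓ))

  invariant-closed : ∀ {f ℓ n labs} → Invariant f ℓ n labs → ℓ ≡ 0ℤ → ¬ n ℕ.< k →
                     ClosedLabelling T (labelled labs)
  invariant-closed {n = n} {labs} inv refl n≮k = record
    { flow-zero       = λ j → trans (trail inv j) (segment-self 0ℤ j)
    ; level0-labelled = at-level0
    ; right-closed    = closed
    }
    where
    at-level0 : ∀ x → r T x ≡ 0ℤ → labelled labs x ≡ true
    at-level0 x rx≡0 with pick-surjective x rx≡0
    ... | m , m<k , m↦x = picked-labelled inv x (m , m<k , ℕP.<-≤-trans m<k (ℕP.≮⇒≥ n≮k) , m↦x)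
    closed : RightClosed T (labelled labs)
    closed x y x≤y same lab with r T x ℤP.≟ 0ℤ
    ... | yes rx≡0 = at-level0 y (trans (sym same) rx≡0)
    ... | no rx≢0  = right-closed inv x y x≤y same rx≢0 lab

  chooseAt-just : ∀ {ℓ labs z} → chooseAt φ T ℓ labs ≡ just z → RightmostUnlabelled ℓ labs z
  chooseAt-just {ℓ} {labs} chosen
    with last-filterᵇ-tabulate (λ j → (r T j ==ℤ ℓ) ∧ not (labelled labs j)) id chosen
  ... | z , refl , unlabelled-at-ℓ , after with ∧-not≡true unlabelled-at-ℓ
  ...   | rz , fresh =
    ⌊⌋-sound (r T z ℤP.≟ ℓ) rz , fresh ,
    λ y z<y ry≡ℓ → ∧-not≡false (after y z<y) (⌊⌋-true (r T y ℤP.≟ ℓ) ry≡ℓ)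

  chooseAt-nothing : ∀ {ℓ labs} → chooseAt φ T ℓ labs ≡ nothing → ∀ i → r T i ≡ ℓ → labelled labs i ≡ true
  chooseAt-nothing {ℓ} {labs} none i ri≡ℓ =
    ∧-not≡false (filterᵇ-tabulate-≡[] unlabelled-at-ℓ id (last≡nothing⇒≡[] _ none) i)
                (⌊⌋-true (r T i ℤP.≟ ℓ) ri≡ℓ)
    where
    unlabelled-at-ℓ : Fin N → Bool
    unlabelled-at-ℓ j = (r T j ==ℤ ℓ) ∧ not (labelled labs j)

  run : Balanced T → ∀ f ℓ n labs → Invariant f ℓ n labs →
        length (step2-go φ T f ℓ n labs) ≡ N ⊎ ClosedLabelling T (labelled (step2-go φ T f ℓ n labs))
  run bal ℕ.zero ℓ n labs inv = inj₁ (trans (sym (ℕP.+-identityʳ _)) (fuel-sum inv))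
  run bal (ℕ.suc f) ℓ n labs inv with ℓ ℤP.≟ 0ℤ
  ... | yes ℓ≡0 with n ℕ.<? k
  ...   | yes n<k = run bal f _ (ℕ.suc n) _ (invariant-at0 inv ℓ≡0 n<k)
  ...   | no  n≮k = inj₂ (invariant-closed inv ℓ≡0 n≮k)
  run bal (ℕ.suc f) ℓ n labs inv | no ℓ≢0 with chooseAt φ T ℓ labs in chosen
  ...   | nothing = contradiction (chooseAt-nothing {ℓ} {labs} chosen)
                                  (path-continues {L = labelled labs} bal ℓ≢0 (trail inv))
  ...   | just z  = run bal f _ n _ (invariant-away inv ℓ≢0 (chooseAt-just {ℓ} {labs} chosen))

step2-closed : ∀ (φ : PermSeq) {N} {T : PathDiagram N} → Balanced T → ¬ Step2Complete φ T →
               ClosedLabelling T (isLabelled φ T (step2 φ T))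
step2-closed φ {N} {T} bal incomplete with Step2.run φ T bal N 0ℤ 0 [] (Step2.invariant-start φ T)
... | inj₁ complete = contradiction complete incomplete
... | inj₂ closed   = closed

step3-increasing-balanced : ∀ (φ : PermSeq) {N} {T : PathDiagram N} → Increasing T → Balanced T →
                            ¬ Step2Complete φ T → Increasing (step3 φ T) × Balanced (step3 φ T)
step3-increasing-balanced φ {T = T} inc bal incomplete =
  lowerUnlabelled-increasing T labels inc right-closed , lowerUnlabelled-balanced T labels bal flow-zero
  where
  labels = isLabelled φ T (step2 φ T)
  open ClosedLabelling (step2-closed φ {T = T} bal incomplete)

step3-firstRankZero : ∀ (φ : PermSeq) {N} {T : PathDiagram N} → Balanced T → ¬ Step2Complete φ T →
                      FirstRankZero T → FirstRankZero (step3 φ T)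
step3-firstRankZero φ {ℕ.zero}  bal incomplete _ = tt
step3-firstRankZero φ {ℕ.suc _} {T} bal incomplete r₁≡0 =
  trans (lowerUnlabelled-labelled T {isLabelled φ T (step2 φ T)} zero (level0-labelled zero r₁≡0)) r₁≡0
  where open ClosedLabelling (step2-closed φ {T = T} bal incomplete)

updates-increasing-balanced : ∀ (φ : PermSeq) {N} {T T′ : PathDiagram N} → Increasing T → Balanced T →
                              Updates φ T T′ → Increasing T′ × Balanced T′
updates-increasing-balanced φ inc bal done = inc , bal
updates-increasing-balanced φ inc bal (next updates incomplete) =
  let inc′ , bal′ = updates-increasing-balanced φ inc bal updates
  in step3-increasing-balanced φ inc′ bal′ incomplete

lemma3 : (φ : PermSeq) (N : ℕ)
    → ((T : PathDiagram N) → NonzeroSteps T → Increasing T → Balanced T → FirstRankZero T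
        → ¬ Step2Complete φ T
        → Increasing (step3 φ T) × Balanced (step3 φ T) × FirstRankZero (step3 φ T))
    × ((T S : PathDiagram N) → NonzeroSteps T → NonnegRanks T → Increasing T → Balanced T
        → Stable φ T S → Increasing S × Balanced S)
lemma3 φ N =
  (λ T _ inc bal r₁≡0 incomplete →
     let inc′ , bal′ = step3-increasing-balanced φ inc bal incomplete
     in inc′ , bal′ , step3-firstRankZero φ bal incomplete r₁≡0)
  , λ T S _ _ inc bal stable → updates-increasing-balanced φ inc bal (proj₁ stable)
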